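{- Let $G$ be a finite almost simple group, let $G^*\le K\le\mathrm{Sym}(G)$, let $L$ be the minimal block of $K$ and $\mathfrak L$ the imprimitivity system of $K$ containing $L$. Then for every $X\in\mathfrak L$ the group $(K_{\mathfrak L})^X$ is primitive and contains $(L^*)^X$.
   Context: $G$ is almost simple if $\mathrm{soc}(G)$ is a nonabelian simple group. For $V\le G$, $V_{left},V_{right}\le\mathrm{Sym}(G)$ are the groups of permutations $g\mapsto xg$, $g\mapsto gx$ ($x\in V$), $V^*=V_{left}V_{right}$. The minimal block $L$ of $K$ is the intersection of all blocks of imprimitivity of $K$ containing the identity of $G$ and having more than one element; it is a normal subgroup of $G$, so the blocks of $\mathfrak L$ are the cosets of $L$ and $L^*$ preserves each of them. $K_{\mathfrak L}$ is the subgroup of $K$ fixing each block of $\mathfrak L$ setwise, and for $X\in\mathfrak L$ and a group $M$ preserving $X$, $M^X$ denotes the group induced by $M$ on $X$. -}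

module Defs where

open import Data.Nat using (ℕ)
open import Data.Fin using (Fin)
open import Data.Fin.Subset using (Subset; _∈_; _⊆_)
open import Data.Fin.Permutation using (Permutation′; _⟨$⟩ʳ_; _⟨$⟩ˡ_; id; _∘ₚ_; flip)
open import Data.Product using (Σ; ∃; _×_; _,_)
open import Data.Sum using (_⊎_)
open import Data.Empty using (⊥)
open import Relation.Nullary using (¬_)
open import Relation.Binary.PropositionalEquality using (_≡_; _≢_)
open import Algebra.Structures using (IsGroup)

-- Finite groups: a group structure (w.r.t. propositional equality) on
-- the carrier Fin n.  Every finite group is isomorphic to one of these.

record FinGroup (n : ℕ) : Set where
  field
    _∙_     : Fin n → Fin n → Fin n
    ε       : Fin n
    _⁻¹     : Fin n → Fin n
    isGroup : IsGroup _≡_ _∙_ ε _⁻¹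
  infixl 7 _∙_
  infix 8 _⁻¹

module GroupTheory {n : ℕ} (G : FinGroup n) where
  open FinGroup G

  IsSubgroup : Subset n → Set
  IsSubgroup H = (ε ∈ H)
               × (∀ x y → x ∈ H → y ∈ H → (x ∙ y) ∈ H)
               × (∀ x → x ∈ H → (x ⁻¹) ∈ H)

  IsNormal : Subset n → Set
  IsNormal N = IsSubgroup N × (∀ g x → x ∈ N → (g ∙ x ∙ g ⁻¹) ∈ N)

  IsTrivial : Subset n → Set
  IsTrivial H = ∀ x → x ∈ H → x ≡ ε

  IsMinimalNormal : Subset n → Set
  IsMinimalNormal N = IsNormal N × ¬ IsTrivial N
                    × (∀ M → IsNormal M → M ⊆ N → IsTrivial M ⊎ N ⊆ M)

  -- the socle: the subgroup generated by all minimal normal subgroups,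
  -- i.e. the intersection of all subgroups containing all of them
  soc : Fin n → Set
  soc x = ∀ (H : Subset n) → IsSubgroup H
        → (∀ N → IsMinimalNormal N → N ⊆ H) → x ∈ H

  SocIsNonabelianSimple : Set
  SocIsNonabelianSimple =
      (∃ λ x → ∃ λ y → soc x × soc y × (x ∙ y ≢ y ∙ x))
    × (∀ (N : Subset n) → (∀ x → x ∈ N → soc x) → IsSubgroup N
        → (∀ g x → soc g → x ∈ N → (g ∙ x ∙ g ⁻¹) ∈ N)
        → IsTrivial N ⊎ (∀ x → soc x → x ∈ N))

IsAlmostSimple : ∀ {n} → FinGroup n → Set
IsAlmostSimple G = GroupTheory.SocIsNonabelianSimple G

record PermGroup (n : ℕ) : Set₁ where
  field
    _∈K    : Permutation′ n → Set
    id∈    : id ∈K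
    ∘∈     : ∀ g h → g ∈K → h ∈K → (g ∘ₚ h) ∈K
    inv∈   : ∀ g → g ∈K → flip g ∈K
    resp   : ∀ g h → (∀ x → g ⟨$⟩ʳ x ≡ h ⟨$⟩ʳ x) → g ∈K → h ∈K

module PermTheory {n : ℕ} where

  image : Permutation′ n → (Fin n → Set) → Fin n → Set
  image k S y = S (k ⟨$⟩ˡ y)

  SetEq : (Fin n → Set) → (Fin n → Set) → Set
  SetEq S T = ∀ x → (S x → T x) × (T x → S x)

  Disjoint : (Fin n → Set) → (Fin n → Set) → Set
  Disjoint S T = ∀ x → S x → T x → ⊥

  IsBlock : (Permutation′ n → Set) → (Fin n → Set) → Set
  IsBlock Q S = (∃ λ x → S x)
              × (∀ k → Q k → SetEq (image k S) S ⊎ Disjoint (image k S) S)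

  IsPrimitiveOn : (Permutation′ n → Set) → (Fin n → Set) → Set
  IsPrimitiveOn Q X =
      (∀ x y → X x → X y → ∃ λ h → Q h × (h ⟨$⟩ʳ x ≡ y))
    × (∀ (B : Subset n) → (∀ x → x ∈ B → X x) → IsBlock Q (_∈ B)
        → (∀ x y → x ∈ B → y ∈ B → x ≡ y) ⊎ (∀ x → X x → x ∈ B))

module Setting {n : ℕ} (G : FinGroup n) (K : PermGroup n) where
  open FinGroup G
  open PermGroup K
  open PermTheory

  -- G* ≤ K : all left and right translations lie in K
  ContainsGStar : Set
  ContainsGStar = (∀ a → ∃ λ k → k ∈K × (∀ g → k ⟨$⟩ʳ g ≡ a ∙ g))
                × (∀ a → ∃ λ k → k ∈K × (∀ g → k ⟨$⟩ʳ g ≡ g ∙ a))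

  -- the minimal block L: intersection of all blocks of K containing
  -- the identity and having more than one element
  L : Fin n → Set
  L x = ∀ (B : Subset n) → IsBlock _∈K (_∈ B) → ε ∈ B
      → (∃ λ y → y ∈ B × y ≢ ε) → x ∈ B

  -- the imprimitivity system 𝔏 = { k(L) | k ∈ K }; X ∈ 𝔏
  In𝔏 : (Fin n → Set) → Set
  In𝔏 X = ∃ λ k → k ∈K × SetEq X (image k L)

  -- K_𝔏 : elements of K fixing every block of 𝔏 setwise
  K𝔏 : Permutation′ n → Set
  K𝔏 h = h ∈K × (∀ k → k ∈K → SetEq (image h (image k L)) (image k L))

  -- (K_𝔏)^X contains (L*)^X: for all a, b ∈ L, the map g ↦ a g b
  -- restricted to X is induced by some element of K_𝔏
  ContainsLStarOn : (Fin n → Set) → Set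
  ContainsLStarOn X = ∀ a b → L a → L b
    → ∃ λ h → K𝔏 h × (∀ x → X x → h ⟨$⟩ʳ x ≡ a ∙ x ∙ b)

-- Write T = soc(G), the unique minimal normal subgroup of G.
--  (1) A set through ε with the block condition for K is invariant under the
--      maps g ↦ g s and g ↦ a g a⁻¹, so it is a normal subgroup of G.  Hence L
--      is a normal subgroup containing T.
--  (2) An element of K fixing ε maps L to a nontrivial block through ε, so it
--      preserves L; therefore every block k(L) ∈ 𝔏 is the coset k(ε) L, and the
--      maps g ↦ a g b (a, b ∈ L) fix all of them: L* ≤ K_𝔏.  Transitivity of
--      K_𝔏 on X = cL follows from the left translations by elements of L.
--  (3) A nontrivial set B ⊆ L through ε with the block condition for K_𝔏 is a
--      subgroup normalised by L; as T is simple with trivial centraliser, B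
--      contains T.  The points z with k(z) ∈ B for all k ∈ K_ε form a subgroup
--      containing T and invariant under K_ε, i.e. a nontrivial block of K, so
--      L ⊆ B.  Translating a block of K_𝔏 inside X with two points into L shows
--      that it is all of X.
-- Membership in L and in K_𝔏 quantifies over all subsets of G, so it is only
-- ¬¬-stable; the classical steps (existence of T, subsets cut out by arbitrary
-- predicates) are carried out in the double-negation monad.
module Submission where

open import Defs
open import Level using (0ℓ)
open import Function using (_∘_)
open import Data.Nat using (ℕ; zero; suc; _<_; s≤s)
open import Data.Nat.Properties using (<-≤-trans)
open import Data.Fin using (Fin) renaming (zero to fzero; suc to fsuc)
open import Data.Fin.Properties using (all?; any?; ¬∀⟶∃¬) renaming (_≟_ to _≟ᶠ_)
open import Data.Fin.Subset using (Subset; _∈_; _⊆_; _∩_; ∣_∣) renaming (⊤ to ⊤ˢ)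
open import Data.Fin.Subset.Properties using (_∈?_; _⊆?_; ∈⊤; x∈p∩q⁺; x∈p∩q⁻; p⊂q⇒∣p∣<∣q∣; ∣p∣≤n)
open import Data.Fin.Permutation using (Permutation′; _⟨$⟩ʳ_; _⟨$⟩ˡ_; id; _∘ₚ_; flip)
  renaming (inverseˡ to unapply-apply; inverseʳ to apply-unapply)
open import Data.Vec using (tabulate)
open import Data.Vec.Properties using (lookup∘tabulate; []=⇒lookup; lookup⇒[]=)
open import Data.Product using (∃; _×_; _,_; proj₁; proj₂)
open import Data.Sum using (_⊎_; inj₁; inj₂)
open import Data.Empty using (⊥-elim)
open import Relation.Nullary using (¬_; Dec; yes; no; does)
open import Relation.Nullary.Decidable using (_→-dec_; _×-dec_; decidable-stable; dec-true; ¬¬-excluded-middle)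
open import Relation.Nullary.Negation using (DoubleNegation; Stable; ¬¬-Monad)
open import Relation.Binary.PropositionalEquality
open import Effect.Monad using (RawMonad)
open import Algebra.Bundles using (Group)
import Algebra.Properties.Group as GroupProperties

open RawMonad (¬¬-Monad {0ℓ}) using (pure; _>>=_)

¬¬-decidable : ∀ {n} (P : Fin n → Set) → DoubleNegation (∀ x → Dec (P x))
¬¬-decidable {zero} P = pure λ ()
¬¬-decidable {suc n} P = do
  P₀? ← ¬¬-excluded-middle
  Pₛ? ← ¬¬-decidable (P ∘ fsuc)
  pure λ { fzero → P₀? ; (fsuc x) → Pₛ? x }

record Extension {n} (P : Fin n → Set) : Set where
  field
    set      : Subset n
    sound    : ∀ {x} → x ∈ set → P x
    complete : ∀ {x} → P x → x ∈ set

extension : ∀ {n} {P : Fin n → Set} → (∀ x → Dec (P x)) → Extension P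
extension {n} {P} P? = record { set = S ; sound = sound ; complete = complete }
  where
  S : Subset n
  S = tabulate (does ∘ P?)
  sound : ∀ {x} → x ∈ S → P x
  sound {x} x∈S with P? x | trans (sym (lookup∘tabulate (does ∘ P?) x)) ([]=⇒lookup x∈S)
  ... | yes px | _ = px
  ... | no _   | ()
  complete : ∀ {x} → P x → x ∈ S
  complete {x} px = lookup⇒[]= x S (trans (lookup∘tabulate (does ∘ P?) x) (dec-true (P? x) px))

¬¬-extension : ∀ {n} (P : Fin n → Set) → DoubleNegation (Extension P)
¬¬-extension P = ¬¬-decidable P >>= λ P? → pure (extension P?)

counterexample : ∀ {n} (S : Subset n) {P : Fin n → Set} → (∀ x → Dec (P x)) →
                 ¬ (∀ x → x ∈ S → P x) → ∃ λ x → x ∈ S × ¬ P x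
counterexample {n} S {P} P? S⊈P = x , x∈S , (λ px → x∉ (λ _ → px))
  where
  witness = ¬∀⟶∃¬ n (λ x → x ∈ S → P x) (λ x → (x ∈? S) →-dec P? x) S⊈P
  x = proj₁ witness
  x∉ = proj₂ witness
  x∈S : x ∈ S
  x∈S = decidable-stable (x ∈? S) (λ x∉S → x∉ (λ x∈S → ⊥-elim (x∉S x∈S)))

module GroupFacts {n : ℕ} (G : FinGroup n) where
  open FinGroup G
  open GroupTheory G
  open ≡-Reasoning

  group : Group 0ℓ 0ℓ
  group = record { Carrier = Fin n ; _≈_ = _≡_ ; _∙_ = _∙_ ; ε = ε ; _⁻¹ = _⁻¹ ; isGroup = isGroup }

  open Group group public using (assoc; identityˡ; identityʳ; inverseˡ; inverseʳ)
  open GroupProperties group public using (⁻¹-involutive; ⁻¹-anti-homo-∙; ∙-cancelˡ; ∙-cancelʳ)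
  open GroupProperties group using (\\-leftDividesˡ; \\-leftDividesʳ; //-rightDividesˡ; //-rightDividesʳ)

  ⁻¹∙-cancel : ∀ x y → x ⁻¹ ∙ (x ∙ y) ≡ y
  ⁻¹∙-cancel = \\-leftDividesʳ

  ∙⁻¹-cancel : ∀ x y → x ∙ (x ⁻¹ ∙ y) ≡ y
  ∙⁻¹-cancel = \\-leftDividesˡ

  ∙∙⁻¹-cancel : ∀ x y → y ∙ x ∙ x ⁻¹ ≡ y
  ∙∙⁻¹-cancel = //-rightDividesʳ

  ∙⁻¹∙-cancel : ∀ x y → y ∙ x ⁻¹ ∙ x ≡ y
  ∙⁻¹∙-cancel = //-rightDividesˡ

  commute-of-commutator : ∀ x t → x ∙ t ∙ x ⁻¹ ∙ t ⁻¹ ≡ ε → x ∙ t ≡ t ∙ x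
  commute-of-commutator x t [x,t]≡ε = ∙-cancelʳ (x ⁻¹) _ _ (begin
    x ∙ t ∙ x ⁻¹   ≡⟨ ∙-cancelʳ (t ⁻¹) _ _ (trans [x,t]≡ε (sym (inverseʳ t))) ⟩
    t              ≡⟨ ∙∙⁻¹-cancel x t ⟨
    t ∙ x ∙ x ⁻¹   ∎)

  conj-∙ : ∀ g a b → g ∙ (a ∙ b) ∙ g ⁻¹ ≡ (g ∙ a ∙ g ⁻¹) ∙ (g ∙ b ∙ g ⁻¹)
  conj-∙ g a b = begin
    g ∙ (a ∙ b) ∙ g ⁻¹                ≡⟨ cong (_∙ g ⁻¹) (assoc _ _ _) ⟨
    (g ∙ a) ∙ b ∙ g ⁻¹                ≡⟨ cong (λ z → (g ∙ a) ∙ z ∙ g ⁻¹) (⁻¹∙-cancel g b) ⟨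
    (g ∙ a) ∙ (g ⁻¹ ∙ (g ∙ b)) ∙ g ⁻¹ ≡⟨ cong (_∙ g ⁻¹) (assoc _ _ _) ⟨
    (g ∙ a ∙ g ⁻¹) ∙ (g ∙ b) ∙ g ⁻¹   ≡⟨ assoc _ _ _ ⟩
    (g ∙ a ∙ g ⁻¹) ∙ (g ∙ b ∙ g ⁻¹)   ∎

  conj-conj⁻¹ : ∀ g t → g ∙ (g ⁻¹ ∙ t ∙ g ⁻¹ ⁻¹) ∙ g ⁻¹ ≡ t
  conj-conj⁻¹ g t = begin
    g ∙ (g ⁻¹ ∙ t ∙ g ⁻¹ ⁻¹) ∙ g ⁻¹ ≡⟨ cong (λ z → g ∙ (g ⁻¹ ∙ t ∙ z) ∙ g ⁻¹) (⁻¹-involutive g) ⟩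
    g ∙ (g ⁻¹ ∙ t ∙ g) ∙ g ⁻¹       ≡⟨ cong (_∙ g ⁻¹) (assoc _ _ _) ⟨
    g ∙ (g ⁻¹ ∙ t) ∙ g ∙ g ⁻¹       ≡⟨ cong (λ z → z ∙ g ∙ g ⁻¹) (∙⁻¹-cancel g t) ⟩
    t ∙ g ∙ g ⁻¹                    ≡⟨ ∙∙⁻¹-cancel g t ⟩
    t                               ∎

  Centralises : Subset n → Fin n → Set
  Centralises T g = ∀ t → t ∈ T → g ∙ t ≡ t ∙ g

  centraliser : (T : Subset n) → Extension (Centralises T)
  centraliser T = extension λ g → all? (λ t → (t ∈? T) →-dec ((g ∙ t) ≟ᶠ (t ∙ g)))

  centraliser-normal : ∀ T → IsNormal T → IsNormal (Extension.set (centraliser T))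
  centraliser-normal T T⊴G =
    (complete ε-central , (λ x y cx cy → complete (∙-central (sound cx) (sound cy)))
                        , (λ x cx → complete (⁻¹-central (sound cx)))) ,
    (λ g x cx → complete (conj-central g (sound cx)))
    where
    open Extension (centraliser T)
    ε-central : Centralises T ε
    ε-central t _ = trans (identityˡ t) (sym (identityʳ t))
    ∙-central : ∀ {x y} → Centralises T x → Centralises T y → Centralises T (x ∙ y)
    ∙-central {x} {y} cx cy t t∈T = begin
      x ∙ y ∙ t   ≡⟨ assoc _ _ _ ⟩
      x ∙ (y ∙ t) ≡⟨ cong (x ∙_) (cy t t∈T) ⟩
      x ∙ (t ∙ y) ≡⟨ assoc _ _ _ ⟨
      x ∙ t ∙ y   ≡⟨ cong (_∙ y) (cx t t∈T) ⟩
      t ∙ x ∙ y   ≡⟨ assoc _ _ _ ⟩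
      t ∙ (x ∙ y) ∎
    ⁻¹-central : ∀ {x} → Centralises T x → Centralises T (x ⁻¹)
    ⁻¹-central {x} cx t t∈T = ∙-cancelˡ x _ _ (begin
      x ∙ (x ⁻¹ ∙ t)   ≡⟨ ∙⁻¹-cancel x t ⟩
      t                ≡⟨ ∙∙⁻¹-cancel x t ⟨
      t ∙ x ∙ x ⁻¹     ≡⟨ cong (_∙ x ⁻¹) (cx t t∈T) ⟨
      x ∙ t ∙ x ⁻¹     ≡⟨ assoc _ _ _ ⟩
      x ∙ (t ∙ x ⁻¹)   ∎)
    conj-central : ∀ g {x} → Centralises T x → Centralises T (g ∙ x ∙ g ⁻¹)
    conj-central g {x} cx t t∈T = begin
      (g ∙ x ∙ g ⁻¹) ∙ t               ≡⟨ cong ((g ∙ x ∙ g ⁻¹) ∙_) (conj-conj⁻¹ g t) ⟨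
      (g ∙ x ∙ g ⁻¹) ∙ (g ∙ s ∙ g ⁻¹)  ≡⟨ conj-∙ g x s ⟨
      g ∙ (x ∙ s) ∙ g ⁻¹               ≡⟨ cong (λ z → g ∙ z ∙ g ⁻¹) (cx s (proj₂ T⊴G (g ⁻¹) t t∈T)) ⟩
      g ∙ (s ∙ x) ∙ g ⁻¹               ≡⟨ conj-∙ g s x ⟩
      (g ∙ s ∙ g ⁻¹) ∙ (g ∙ x ∙ g ⁻¹)  ≡⟨ cong (_∙ (g ∙ x ∙ g ⁻¹)) (conj-conj⁻¹ g t) ⟩
      t ∙ (g ∙ x ∙ g ⁻¹)               ∎
      where s = g ⁻¹ ∙ t ∙ g ⁻¹ ⁻¹

  trivial? : ∀ M → Dec (IsTrivial M)
  trivial? M = all? (λ x → (x ∈? M) →-dec (x ≟ᶠ ε))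

  ContainsMinimalNormal : Subset n → Set
  ContainsMinimalNormal N = ∃ λ M → IsMinimalNormal M × M ⊆ N

  -- Classically, every nontrivial normal subgroup N contains a minimal
  -- normal subgroup: either N itself is minimal, or it contains a smaller
  -- nontrivial normal subgroup (induction on a strict bound for ∣ N ∣).
  ¬¬-minimal-normal : ∀ N → IsNormal N → ¬ IsTrivial N → DoubleNegation (ContainsMinimalNormal N)
  ¬¬-minimal-normal N = descend (suc n) N (s≤s (∣p∣≤n N))
    where
    descend : ∀ m N → ∣ N ∣ < m → IsNormal N → ¬ IsTrivial N → DoubleNegation (ContainsMinimalNormal N)
    descend (suc m) N (s≤s ∣N∣≤m) N⊴G N≢1 noMinimal = noMinimal (N , (N⊴G , N≢1 , minimal) , λ x∈N → x∈N)
      where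
      minimal : ∀ M → IsNormal M → M ⊆ N → IsTrivial M ⊎ N ⊆ M
      minimal M M⊴G M⊆N with trivial? M | N ⊆? M
      ... | yes M≡1 | _      = inj₁ M≡1
      ... | no _    | yes N⊆M = inj₂ N⊆M
      ... | no M≢1  | no N⊈M  = ⊥-elim (descend m M (<-≤-trans ∣M∣<∣N∣ ∣N∣≤m) M⊴G M≢1
              λ { (M′ , M′-minimal , M′⊆M) → noMinimal (M′ , M′-minimal , M⊆N ∘ M′⊆M) })
        where
        missing = counterexample N (_∈? M) (λ N⊆M → N⊈M (λ {x} → N⊆M x))
        ∣M∣<∣N∣ : ∣ M ∣ < ∣ N ∣
        ∣M∣<∣N∣ = p⊂q⇒∣p∣<∣q∣ (M⊆N , proj₁ missing , proj₂ missing)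

  sandwich-cancel : ∀ a b y → a ∙ (a ⁻¹ ∙ y ∙ b ⁻¹) ∙ b ≡ y
  sandwich-cancel a b y = begin
    a ∙ (a ⁻¹ ∙ y ∙ b ⁻¹) ∙ b   ≡⟨ cong (_∙ b) (assoc a (a ⁻¹ ∙ y) (b ⁻¹)) ⟨
    a ∙ (a ⁻¹ ∙ y) ∙ b ⁻¹ ∙ b   ≡⟨ ∙⁻¹∙-cancel b _ ⟩
    a ∙ (a ⁻¹ ∙ y)              ≡⟨ ∙⁻¹-cancel a y ⟩
    y                           ∎

  record IsSubgroupPredicate (H : Fin n → Set) : Set where
    field
      ε∈  : H ε
      ∙∈  : ∀ {x y} → H x → H y → H (x ∙ y)
      ⁻¹∈ : ∀ {x} → H x → H (x ⁻¹)

  record IsNormalPredicate (N : Fin n → Set) : Set where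
    field
      isSubgroup : IsSubgroupPredicate N
      conj∈      : ∀ g {x} → N x → N (g ∙ x ∙ g ⁻¹)
    open IsSubgroupPredicate isSubgroup public

  normal-subset : ∀ {S} → IsNormalPredicate (_∈ S) → IsNormal S
  normal-subset S⊴G = (ε∈ , (λ _ _ → ∙∈) , (λ _ → ⁻¹∈)) , (λ g _ → conj∈ g)
    where open IsNormalPredicate S⊴G

  normal-predicate : ∀ {S} → IsNormal S → IsNormalPredicate (_∈ S)
  normal-predicate ((ε∈S , ∙∈S , ⁻¹∈S) , conj∈S) = record
    { isSubgroup = record { ε∈ = ε∈S ; ∙∈ = ∙∈S _ _ ; ⁻¹∈ = ⁻¹∈S _ }
    ; conj∈      = λ g → conj∈S g _
    }

  ∩-subgroup : ∀ {S S′} → IsSubgroupPredicate (_∈ S) → IsSubgroupPredicate (_∈ S′) → IsSubgroup (S ∩ S′)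
  ∩-subgroup {S} {S′} S≤G S′≤G =
    x∈p∩q⁺ (S.ε∈ , S′.ε∈) ,
    (λ x y x∈ y∈ → x∈p∩q⁺ (S.∙∈ (left x∈) (left y∈) , S′.∙∈ (right x∈) (right y∈))) ,
    (λ x x∈ → x∈p∩q⁺ (S.⁻¹∈ (left x∈) , S′.⁻¹∈ (right x∈)))
    where
    module S  = IsSubgroupPredicate S≤G
    module S′ = IsSubgroupPredicate S′≤G
    left  = λ {x} x∈ → proj₁ (x∈p∩q⁻ {x = x} S S′ x∈)
    right = λ {x} x∈ → proj₂ (x∈p∩q⁻ {x = x} S S′ x∈)

  -- Left cosets cN of a normal subgroup N (x ∈ cN meaning N (c ⁻¹ ∙ x)).
  module Cosets {N : Fin n → Set} (N⊴G : IsNormalPredicate N) where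
    open IsNormalPredicate N⊴G

    coset-quotientˡ : ∀ c {x y} → N (c ⁻¹ ∙ x) → N (c ⁻¹ ∙ y) → N (x ⁻¹ ∙ y)
    coset-quotientˡ c {x} {y} x∈cN y∈cN = subst N eq (∙∈ (⁻¹∈ x∈cN) y∈cN)
      where
      eq : (c ⁻¹ ∙ x) ⁻¹ ∙ (c ⁻¹ ∙ y) ≡ x ⁻¹ ∙ y
      eq = begin
        (c ⁻¹ ∙ x) ⁻¹ ∙ (c ⁻¹ ∙ y)     ≡⟨ cong (_∙ (c ⁻¹ ∙ y)) (⁻¹-anti-homo-∙ (c ⁻¹) x) ⟩
        x ⁻¹ ∙ c ⁻¹ ⁻¹ ∙ (c ⁻¹ ∙ y)    ≡⟨ assoc _ _ _ ⟩
        x ⁻¹ ∙ (c ⁻¹ ⁻¹ ∙ (c ⁻¹ ∙ y))  ≡⟨ cong (x ⁻¹ ∙_) (⁻¹∙-cancel (c ⁻¹) y) ⟩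
        x ⁻¹ ∙ y                       ∎

    coset-quotientʳ : ∀ c {x y} → N (c ⁻¹ ∙ x) → N (c ⁻¹ ∙ y) → N (y ∙ x ⁻¹)
    coset-quotientʳ c {x} {y} x∈cN y∈cN =
      subst N (cong (_∙ x ⁻¹) (∙⁻¹-cancel x y)) (conj∈ x (coset-quotientˡ c x∈cN y∈cN))

    coset-stable : ∀ c {a b y} → N a → N b → N (c ⁻¹ ∙ y) → N (c ⁻¹ ∙ (a ∙ y ∙ b))
    coset-stable c {a} {b} {y} a∈N b∈N y∈cN =
      subst N (sym eq) (∙∈ (∙∈ (conj∈ (c ⁻¹) a∈N) y∈cN) b∈N)
      where
      eq : c ⁻¹ ∙ (a ∙ y ∙ b) ≡ c ⁻¹ ∙ a ∙ c ⁻¹ ⁻¹ ∙ (c ⁻¹ ∙ y) ∙ b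
      eq = begin
        c ⁻¹ ∙ (a ∙ y ∙ b)                      ≡⟨ assoc _ _ _ ⟨
        c ⁻¹ ∙ (a ∙ y) ∙ b                      ≡⟨ cong (_∙ b) (assoc _ _ _) ⟨
        c ⁻¹ ∙ a ∙ y ∙ b                        ≡⟨ cong (λ z → c ⁻¹ ∙ a ∙ z ∙ b) (⁻¹∙-cancel (c ⁻¹) y) ⟨
        c ⁻¹ ∙ a ∙ (c ⁻¹ ⁻¹ ∙ (c ⁻¹ ∙ y)) ∙ b   ≡⟨ cong (_∙ b) (assoc _ _ _) ⟨
        c ⁻¹ ∙ a ∙ c ⁻¹ ⁻¹ ∙ (c ⁻¹ ∙ y) ∙ b     ∎

module AlmostSimple {n : ℕ} (G : FinGroup n) (almost-simple : IsAlmostSimple G) where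
  open FinGroup G
  open GroupTheory G
  open GroupFacts G

  private
    x₀ y₀ : Fin n
    x₀ = proj₁ (proj₁ almost-simple)
    y₀ = proj₁ (proj₂ (proj₁ almost-simple))
    x₀∈soc : soc x₀
    x₀∈soc = proj₁ (proj₂ (proj₂ (proj₁ almost-simple)))
    y₀∈soc : soc y₀
    y₀∈soc = proj₁ (proj₂ (proj₂ (proj₂ (proj₁ almost-simple))))
    x₀y₀≢y₀x₀ : x₀ ∙ y₀ ≢ y₀ ∙ x₀
    x₀y₀≢y₀x₀ = proj₂ (proj₂ (proj₂ (proj₂ (proj₁ almost-simple))))
    soc-simple = proj₂ almost-simple

  minimal-normal⊆soc : ∀ M → IsMinimalNormal M → ∀ {x} → x ∈ M → soc x
  minimal-normal⊆soc M M-minimal x∈M _ _ minimals⊆H = minimals⊆H M M-minimal x∈M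

  record Socle : Set where
    field
      T         : Subset n
      T-minimal : IsMinimalNormal T
      T-least   : ∀ N → IsNormal N → ¬ IsTrivial N → T ⊆ N

  -- Any two minimal normal subgroups coincide, as both equal soc(G).
  minimal-normal-unique : ∀ M M′ → IsMinimalNormal M → IsMinimalNormal M′ → M′ ⊆ M
  minimal-normal-unique M M′ M-minimal M′-minimal {x} x∈M′
    with soc-simple M (λ y y∈M → minimal-normal⊆soc M M-minimal y∈M)
           (proj₁ (proj₁ M-minimal)) (λ g y _ y∈M → proj₂ (proj₁ M-minimal) g y y∈M)
  ... | inj₁ M≡1   = ⊥-elim (proj₁ (proj₂ M-minimal) M≡1)
  ... | inj₂ soc⊆M = soc⊆M x (minimal-normal⊆soc M′ M′-minimal x∈M′)

  G⊴G : IsNormal ⊤ˢ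
  G⊴G = (∈⊤ , (λ _ _ _ _ → ∈⊤) , (λ _ _ → ∈⊤)) , (λ _ _ _ → ∈⊤)

  G≢1 : ¬ IsTrivial ⊤ˢ
  G≢1 G≡1 = x₀y₀≢y₀x₀ (begin
    x₀ ∙ y₀ ≡⟨ cong (_∙ y₀) (G≡1 x₀ ∈⊤) ⟩
    ε ∙ y₀  ≡⟨ trans (identityˡ y₀) (sym (identityʳ y₀)) ⟩
    y₀ ∙ ε  ≡⟨ cong (y₀ ∙_) (G≡1 x₀ ∈⊤) ⟨
    y₀ ∙ x₀ ∎)
    where open ≡-Reasoning

  -- Classically T exists: take a minimal normal subgroup T of G; every
  -- nontrivial normal N contains a minimal normal subgroup, which equals T.
  ¬¬-socle : DoubleNegation Socle
  ¬¬-socle = ¬¬-minimal-normal ⊤ˢ G⊴G G≢1 >>= λ { (T , T-minimal , _) → pure (record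
    { T = T ; T-minimal = T-minimal ; T-least = λ N N⊴G N≢1 {x} x∈T →
        decidable-stable (x ∈? N) (λ x∉N → ¬¬-minimal-normal N N⊴G N≢1 λ { (M , M-minimal , M⊆N) →
          x∉N (M⊆N (minimal-normal-unique M T M-minimal T-minimal x∈T)) }) }) }

  module WithSocle (socle : Socle) where
    open Socle socle public

    T⊴G : IsNormal T
    T⊴G = proj₁ T-minimal

    module T = IsNormalPredicate (normal-predicate T⊴G)

    T⊆soc : ∀ {x} → x ∈ T → soc x
    T⊆soc = minimal-normal⊆soc T T-minimal

    soc⊆T : ∀ {x} → soc x → x ∈ T
    soc⊆T x∈soc = x∈soc T (proj₁ T⊴G) (λ M M-minimal → minimal-normal-unique T M T-minimal M-minimal)

    T≢1 : ∃ λ t → t ∈ T × t ≢ ε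
    T≢1 = counterexample T (_≟ᶠ ε) (λ T≡1 → proj₁ (proj₂ T-minimal) T≡1)

    -- T is nonabelian, so its centraliser, a normal subgroup not containing T,
    -- is trivial.
    centraliser-trivial : ∀ z → Centralises T z → z ≡ ε
    centraliser-trivial z z∈C = decidable-stable (z ≟ᶠ ε) λ z≢ε →
      x₀y₀≢y₀x₀ (x₀∈C z≢ε y₀ (soc⊆T y₀∈soc))
      where
      open Extension (centraliser T)
      x₀∈C : z ≢ ε → Centralises T x₀
      x₀∈C z≢ε = sound (T-least set (centraliser-normal T T⊴G)
                          (λ C≡1 → z≢ε (C≡1 z (complete z∈C))) (soc⊆T x₀∈soc))

    T-simple : ∀ D → (∀ {x} → x ∈ D → x ∈ T) → IsSubgroup D →
               (∀ g x → g ∈ T → x ∈ D → (g ∙ x ∙ g ⁻¹) ∈ D) → IsTrivial D ⊎ T ⊆ D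
    T-simple D D⊆T D≤G T-normalises-D
      with soc-simple D (λ x x∈D → T⊆soc (D⊆T x∈D)) D≤G (λ g x g∈soc → T-normalises-D g x (soc⊆T g∈soc))
    ... | inj₁ D≡1   = inj₁ D≡1
    ... | inj₂ soc⊆D = inj₂ (λ {x} x∈T → soc⊆D x (T⊆soc x∈T))

module Blocks {n : ℕ} where
  open PermTheory {n}

  Perm : Set
  Perm = Permutation′ n

  -- The block condition for a possibly empty set P: an element of Q mapping
  -- some point of P into P maps P onto P.  (image k P x means x ∈ k(P).)
  BlockCondition : (Perm → Set) → (Fin n → Set) → Set
  BlockCondition Q P = ∀ k → Q k → ∀ x → P x → image k P x → SetEq (image k P) P

  block⇒condition : ∀ {Q P} → IsBlock Q P → BlockCondition Q P
  block⇒condition (_ , onto-or-disjoint) k k∈Q x x∈P x∈kP with onto-or-disjoint k k∈Q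
  ... | inj₁ kP≡P    = kP≡P
  ... | inj₂ kP∩P≡∅ = ⊥-elim (kP∩P≡∅ x x∈kP x∈P)

  condition⇒block : ∀ {Q} (S : Subset n) → BlockCondition Q (_∈ S) → ∃ (_∈ S) → IsBlock Q (_∈ S)
  condition⇒block {Q} S condition S≢∅ = S≢∅ , onto-or-disjoint
    where
    onto-or-disjoint : ∀ k → Q k → SetEq (image k (_∈ S)) (_∈ S) ⊎ Disjoint (image k (_∈ S)) (_∈ S)
    onto-or-disjoint k k∈Q with any? (λ x → (x ∈? S) ×-dec ((k ⟨$⟩ˡ x) ∈? S))
    ... | yes (x , x∈S , x∈kS) = inj₁ (condition k k∈Q x x∈S x∈kS)
    ... | no  kS∩S≡∅          = inj₂ (λ x x∈kS x∈S → kS∩S≡∅ (x , x∈S , x∈kS))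

  condition-resp : ∀ {Q P P′} → BlockCondition Q P → SetEq P P′ → BlockCondition Q P′
  condition-resp condition P≐P′ k k∈Q x x∈P′ x∈kP′ y =
    (λ y∈kP′ → to y (proj₁ (kP≐P y) (from _ y∈kP′))) ,
    (λ y∈P′ → to _ (proj₂ (kP≐P y) (from y y∈P′)))
    where
    to   = λ z → proj₁ (P≐P′ z)
    from = λ z → proj₂ (P≐P′ z)
    kP≐P = condition k k∈Q x (from x x∈P′) (from _ x∈kP′)

  module _ {Q P} (condition : BlockCondition Q P) {k} (k∈Q : Q k)
           {x} (x∈P : P x) (kx∈P : P (k ⟨$⟩ʳ x)) where
    private
      kP≐P : SetEq (image k P) P
      kP≐P = condition k k∈Q (k ⟨$⟩ʳ x) kx∈P (subst P (sym (unapply-apply k)) x∈P)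

    image-inside : ∀ {y} → P y → P (k ⟨$⟩ʳ y)
    image-inside {y} y∈P = proj₁ (kP≐P (k ⟨$⟩ʳ y)) (subst P (sym (unapply-apply k)) y∈P)

    preimage-inside : ∀ {y} → P y → P (k ⟨$⟩ˡ y)
    preimage-inside {y} y∈P = proj₂ (kP≐P y) y∈P

  -- Conjugation of h by k (first k, then h, then k⁻¹).
  conjugate : Perm → Perm → Perm
  conjugate k h = k ∘ₚ h ∘ₚ flip k

  condition-image : ∀ {Q P} → BlockCondition Q P → ∀ k → (∀ h → Q h → Q (conjugate k h)) →
                    BlockCondition Q (image k P)
  condition-image {Q} {P} condition k k-normalises h h∈Q x x∈kP x∈hkP y =
    (λ y∈hkP → proj₁ (k⁻¹hkP≐P (k ⟨$⟩ˡ y)) (to-conjugate y∈hkP)) ,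
    (λ y∈kP → from-conjugate (proj₂ (k⁻¹hkP≐P (k ⟨$⟩ˡ y)) y∈kP))
    where
    to-conjugate : ∀ {z} → P (k ⟨$⟩ˡ (h ⟨$⟩ˡ z)) → P (conjugate k h ⟨$⟩ˡ (k ⟨$⟩ˡ z))
    to-conjugate = subst P (cong (λ w → k ⟨$⟩ˡ (h ⟨$⟩ˡ w)) (sym (apply-unapply k)))
    from-conjugate : ∀ {z} → P (conjugate k h ⟨$⟩ˡ (k ⟨$⟩ˡ z)) → P (k ⟨$⟩ˡ (h ⟨$⟩ˡ z))
    from-conjugate = subst P (cong (λ w → k ⟨$⟩ˡ (h ⟨$⟩ˡ w)) (apply-unapply k))
    k⁻¹hkP≐P : SetEq (image (conjugate k h) P) P
    k⁻¹hkP≐P = condition (conjugate k h) (k-normalises h h∈Q) (k ⟨$⟩ˡ x) x∈kP (to-conjugate x∈hkP)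

module Argument {n : ℕ} (G : FinGroup n) (K : PermGroup n)
                (almost-simple : IsAlmostSimple G) (G*≤K : Setting.ContainsGStar G K) where
  open FinGroup G
  open PermGroup K
  open PermTheory {n}
  open Setting G K
  open GroupTheory G
  open GroupFacts G
  open AlmostSimple G almost-simple using (Socle; ¬¬-socle; module WithSocle)
  open Blocks {n}
  open ≡-Reasoning

  unapply-of : ∀ (k : Perm) {f : Fin n → Fin n} → (∀ g → k ⟨$⟩ʳ g ≡ f g) →
               ∀ {x y} → f x ≡ y → k ⟨$⟩ˡ y ≡ x
  unapply-of k {f} k≗f {x} {y} fx≡y = begin
    k ⟨$⟩ˡ y              ≡⟨ cong (k ⟨$⟩ˡ_) (trans (sym fx≡y) (sym (k≗f x))) ⟩
    k ⟨$⟩ˡ (k ⟨$⟩ʳ x)     ≡⟨ unapply-apply k ⟩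
    x                    ∎

  left : Fin n → Perm
  left a = proj₁ (proj₁ G*≤K a)

  left-∈K : ∀ a → left a ∈K
  left-∈K a = proj₁ (proj₂ (proj₁ G*≤K a))

  left-apply : ∀ a g → left a ⟨$⟩ʳ g ≡ a ∙ g
  left-apply a = proj₂ (proj₂ (proj₁ G*≤K a))

  right : Fin n → Perm
  right a = proj₁ (proj₂ G*≤K a)

  right-∈K : ∀ a → right a ∈K
  right-∈K a = proj₁ (proj₂ (proj₂ G*≤K a))

  right-apply : ∀ a g → right a ⟨$⟩ʳ g ≡ g ∙ a
  right-apply a = proj₂ (proj₂ (proj₂ G*≤K a))

  two-sided : Fin n → Fin n → Perm
  two-sided a b = right b ∘ₚ left a

  two-sided-∈K : ∀ a b → two-sided a b ∈K
  two-sided-∈K a b = ∘∈ _ _ (right-∈K b) (left-∈K a)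

  two-sided-apply : ∀ a b x → two-sided a b ⟨$⟩ʳ x ≡ a ∙ x ∙ b
  two-sided-apply a b x = trans (left-apply a _) (trans (cong (a ∙_) (right-apply b x)) (sym (assoc _ _ _)))

  K-normalises-K : ∀ k → k ∈K → ∀ h → h ∈K → conjugate k h ∈K
  K-normalises-K k k∈K h h∈K = ∘∈ _ _ k∈K (∘∈ _ _ h∈K (inv∈ k k∈K))

  module BlockThroughε {Q : Perm → Set} {P : Fin n → Set}
                       (condition : BlockCondition Q P) (ε∈P : P ε) where
    subgroup : (∀ {s} → P s → Q (right s)) → IsSubgroupPredicate P
    subgroup right-∈Q = record
      { ε∈  = ε∈P
      ; ∙∈  = λ {x} {s} x∈P s∈P → subst P (right-apply s x) (image-inside condition (right-∈Q s∈P) ε∈P (εs∈P s∈P) x∈P)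
      ; ⁻¹∈ = λ {s} s∈P → subst P (trans (unapply-of (right s) (right-apply s) (∙⁻¹∙-cancel s ε)) (identityˡ _))
                            (preimage-inside condition (right-∈Q s∈P) ε∈P (εs∈P s∈P) ε∈P)
      }
      where
      εs∈P : ∀ {s} → P s → P (right s ⟨$⟩ʳ ε)
      εs∈P {s} = subst P (sym (trans (right-apply s ε) (identityˡ s)))

    conj-closed : ∀ g → Q (two-sided g (g ⁻¹)) → ∀ {y} → P y → P (g ∙ y ∙ g ⁻¹)
    conj-closed g γ∈Q y∈P = subst P (two-sided-apply g (g ⁻¹) _) (image-inside condition γ∈Q ε∈P gεg⁻¹∈P y∈P)
      where
      gεg⁻¹∈P : P (two-sided g (g ⁻¹) ⟨$⟩ʳ ε)
      gεg⁻¹∈P = subst P (sym (trans (two-sided-apply g (g ⁻¹) ε)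
                                    (trans (cong (_∙ g ⁻¹) (identityʳ g)) (inverseʳ g)))) ε∈P

  block-normal : ∀ {P} → BlockCondition _∈K P → P ε → IsNormalPredicate P
  block-normal condition ε∈P = record
    { isSubgroup = subgroup (λ {s} _ → right-∈K s)
    ; conj∈      = λ g → conj-closed g (two-sided-∈K g (g ⁻¹))
    }
    where open BlockThroughε condition ε∈P

  L-stable : ∀ x → Stable (L x)
  L-stable x ¬¬x∈L B B-block ε∈B B≢1 =
    decidable-stable (x ∈? B) (λ x∉B → ¬¬x∈L (λ x∈L → x∉B (x∈L B B-block ε∈B B≢1)))

  ε∈L : L ε
  ε∈L _ _ ε∈B _ = ε∈B

  -- As an intersection of blocks, L satisfies the block condition.
  L-condition : BlockCondition _∈K L
  L-condition k k∈K x x∈L x∈kL y =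
    (λ y∈kL B B-block ε∈B B≢1 → proj₁ (kB≐B B B-block ε∈B B≢1) (y∈kL B B-block ε∈B B≢1)) ,
    (λ y∈L  B B-block ε∈B B≢1 → proj₂ (kB≐B B B-block ε∈B B≢1) (y∈L  B B-block ε∈B B≢1))
    where
    kB≐B = λ B B-block ε∈B B≢1 →
      block⇒condition B-block k k∈K x (x∈L B B-block ε∈B B≢1) (x∈kL B B-block ε∈B B≢1) y

  L⊴G : IsNormalPredicate L
  L⊴G = block-normal L-condition ε∈L

  open Cosets L⊴G

  -- L lies in every set through ε with a second point and the block
  -- condition for K (classically, such a set is one of the blocks defining L).
  ¬¬-L⊆block : ∀ {P} → BlockCondition _∈K P → P ε → (∃ λ y → P y × y ≢ ε) →
               ∀ {z} → L z → DoubleNegation (P z)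
  ¬¬-L⊆block {P} condition ε∈P (y , y∈P , y≢ε) {z} z∈L = ¬¬-extension P >>= λ P-ext →
    let open Extension P-ext
        S-block = condition⇒block set (condition-resp condition (λ _ → complete , sound)) (ε , complete ε∈P)
    in pure (sound (z∈L set S-block (complete ε∈P) (y , complete y∈P , y≢ε)))

  K𝔏-stable : ∀ h → h ∈K → Stable (K𝔏 h)
  K𝔏-stable h h∈K ¬¬h∈K𝔏 = h∈K , λ k k∈K y →
    (λ y∈hkL → L-stable _ (λ y∉kL → ¬¬h∈K𝔏 (λ h∈K𝔏 → y∉kL (proj₁ (proj₂ h∈K𝔏 k k∈K y) y∈hkL)))) ,
    (λ y∈kL  → L-stable _ (λ y∉hkL → ¬¬h∈K𝔏 (λ h∈K𝔏 → y∉hkL (proj₂ (proj₂ h∈K𝔏 k k∈K y) y∈kL))))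

  K𝔏⊴K : ∀ k → k ∈K → ∀ h → K𝔏 h → K𝔏 (conjugate k h)
  K𝔏⊴K k k∈K h (h∈K , h-fixes-blocks) = K-normalises-K k k∈K h h∈K , λ k′ k′∈K y →
    (λ y∈k⁻¹hkk′L → subst L (cong (k′ ⟨$⟩ˡ_) (unapply-apply k)) (proj₁ (fixes k′ k′∈K y) y∈k⁻¹hkk′L)) ,
    (λ y∈k′L → proj₂ (fixes k′ k′∈K y) (subst L (cong (k′ ⟨$⟩ˡ_) (sym (unapply-apply k))) y∈k′L))
    where
    fixes = λ k′ k′∈K y → h-fixes-blocks (k′ ∘ₚ k) (∘∈ _ _ k′∈K k∈K) (k ⟨$⟩ʳ y)

  Fixesε : Perm → Set
  Fixesε k = k ⟨$⟩ʳ ε ≡ ε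

  inverse-fixesε : ∀ k → Fixesε k → Fixesε (flip k)
  inverse-fixesε k kε≡ε = trans (cong (k ⟨$⟩ˡ_) (sym kε≡ε)) (unapply-apply k)

  -- A subgroup C of G invariant under the stabiliser K_ε satisfies the block
  -- condition for K: if x ∈ C ∩ k(C), then z ↦ k(z ∙ k⁻¹(x)) ∙ x⁻¹ lies in K_ε,
  -- and k is this map composed with translations by elements of C.
  stabiliser-invariant-condition : ∀ {C} → IsSubgroupPredicate C →
    (∀ k → k ∈K → Fixesε k → ∀ {z} → C z → C (k ⟨$⟩ʳ z)) → BlockCondition _∈K C
  stabiliser-invariant-condition {C} C≤G K_ε-invariant k k∈K x x∈C x′∈C y =
    (λ k⁻¹y∈C → subst C (∙⁻¹∙-cancel x y) (∙∈ (subst C (k′-shift-y y)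
                   (K_ε-invariant k′ k′∈K k′ε≡ε (∙∈ k⁻¹y∈C (⁻¹∈ x′∈C)))) x∈C)) ,
    (λ y∈C → subst C (∙⁻¹∙-cancel x′ (k ⟨$⟩ˡ y)) (∙∈ (subst C (unapply-apply k′)
                (K_ε-invariant (flip k′) (inv∈ k′ k′∈K) (inverse-fixesε k′ k′ε≡ε)
                  (subst C (sym (k′-shift-y y)) (∙∈ y∈C (⁻¹∈ x∈C))))) x′∈C))
    where
    open IsSubgroupPredicate C≤G
    x′ = k ⟨$⟩ˡ x
    k′ : Perm
    k′ = right x′ ∘ₚ (k ∘ₚ right (x ⁻¹))
    k′∈K : k′ ∈K
    k′∈K = ∘∈ _ _ (right-∈K x′) (∘∈ _ _ k∈K (right-∈K (x ⁻¹)))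
    k′-shift : ∀ z → k′ ⟨$⟩ʳ (z ∙ x′ ⁻¹) ≡ (k ⟨$⟩ʳ z) ∙ x ⁻¹
    k′-shift z = trans (right-apply (x ⁻¹) _)
                   (cong (λ v → (k ⟨$⟩ʳ v) ∙ x ⁻¹) (trans (right-apply x′ _) (∙⁻¹∙-cancel x′ z)))
    k′-shift-y : ∀ y → k′ ⟨$⟩ʳ ((k ⟨$⟩ˡ y) ∙ x′ ⁻¹) ≡ y ∙ x ⁻¹
    k′-shift-y y = trans (k′-shift (k ⟨$⟩ˡ y)) (cong (_∙ x ⁻¹) (apply-unapply k))
    k′ε≡ε : Fixesε k′
    k′ε≡ε = begin
      k′ ⟨$⟩ʳ ε                ≡⟨ cong (k′ ⟨$⟩ʳ_) (inverseʳ x′) ⟨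
      k′ ⟨$⟩ʳ (x′ ∙ x′ ⁻¹)     ≡⟨ k′-shift x′ ⟩
      (k ⟨$⟩ʳ x′) ∙ x ⁻¹       ≡⟨ cong (_∙ x ⁻¹) (apply-unapply k) ⟩
      x ∙ x ⁻¹                 ≡⟨ inverseʳ x ⟩
      ε                        ∎

  module GivenSocle (socle : Socle) where
    open WithSocle socle

    -- Every nontrivial block of K through ε is a nontrivial normal
    -- subgroup, so it contains T; hence so does L.
    T⊆L : ∀ {t} → t ∈ T → L t
    T⊆L t∈T B B-block ε∈B (y , y∈B , y≢ε) =
      T-least B (normal-subset (block-normal (block⇒condition B-block) ε∈B)) (λ B≡1 → y≢ε (B≡1 y y∈B)) t∈T

    -- An element k of K fixing ε maps L onto a nontrivial block through ε,
    -- which therefore contains L: k⁻¹ preserves L, and so does k.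
    stabiliser-preserves-Lˡ : ∀ k → k ∈K → Fixesε k → ∀ {z} → L z → L (k ⟨$⟩ˡ z)
    stabiliser-preserves-Lˡ k k∈K kε≡ε z∈L =
      L-stable _ (¬¬-L⊆block (condition-image L-condition k (K-normalises-K k k∈K)) ε∈kL kL≢1 z∈L)
      where
      k⁻¹ε≡ε : k ⟨$⟩ˡ ε ≡ ε
      k⁻¹ε≡ε = inverse-fixesε k kε≡ε
      ε∈kL : image k L ε
      ε∈kL = subst L (sym k⁻¹ε≡ε) ε∈L
      kL≢1 : ∃ λ y → image k L y × y ≢ ε
      kL≢1 = let (t , t∈T , t≢ε) = T≢1 in
        k ⟨$⟩ʳ t , subst L (sym (unapply-apply k)) (T⊆L t∈T) ,
        (λ kt≡ε → t≢ε (trans (sym (unapply-apply k)) (trans (cong (k ⟨$⟩ˡ_) kt≡ε) k⁻¹ε≡ε)))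

    stabiliser-preserves-Lʳ : ∀ k → k ∈K → Fixesε k → ∀ {z} → L z → L (k ⟨$⟩ʳ z)
    stabiliser-preserves-Lʳ k k∈K kε≡ε = stabiliser-preserves-Lˡ (flip k) (inv∈ k k∈K) (inverse-fixesε k kε≡ε)

    block-is-coset : ∀ k → k ∈K → ∀ y → (L (k ⟨$⟩ˡ y) → L ((k ⟨$⟩ʳ ε) ⁻¹ ∙ y))
                                      × (L ((k ⟨$⟩ʳ ε) ⁻¹ ∙ y) → L (k ⟨$⟩ˡ y))
    block-is-coset k k∈K y =
      (λ k⁻¹y∈L → subst L (trans (left-apply (c ⁻¹) _) (cong (c ⁻¹ ∙_) (apply-unapply k)))
                           (stabiliser-preserves-Lʳ k₁ k₁∈K k₁ε≡ε k⁻¹y∈L)) ,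
      (λ c⁻¹y∈L → subst L k₁⁻¹[c⁻¹y]≡k⁻¹y (stabiliser-preserves-Lˡ k₁ k₁∈K k₁ε≡ε c⁻¹y∈L))
      where
      c = k ⟨$⟩ʳ ε
      k₁ = k ∘ₚ left (c ⁻¹)
      k₁∈K : k₁ ∈K
      k₁∈K = ∘∈ _ _ k∈K (left-∈K (c ⁻¹))
      k₁ε≡ε : Fixesε k₁
      k₁ε≡ε = trans (left-apply (c ⁻¹) c) (inverseˡ c)
      k₁⁻¹[c⁻¹y]≡k⁻¹y : k₁ ⟨$⟩ˡ (c ⁻¹ ∙ y) ≡ k ⟨$⟩ˡ y
      k₁⁻¹[c⁻¹y]≡k⁻¹y = unapply-of k₁ (λ g → left-apply (c ⁻¹) (k ⟨$⟩ʳ g)) (cong (c ⁻¹ ∙_) (apply-unapply k))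

    L*⊆K𝔏 : ∀ h {a b} → h ∈K → (∀ x → h ⟨$⟩ʳ x ≡ a ∙ x ∙ b) → L a → L b → K𝔏 h
    L*⊆K𝔏 h {a} {b} h∈K h-acts a∈L b∈L = h∈K , fixes-block
      where
      open IsNormalPredicate L⊴G using (⁻¹∈)
      h⁻¹y : ∀ {y} → h ⟨$⟩ˡ y ≡ a ⁻¹ ∙ y ∙ b ⁻¹
      h⁻¹y {y} = unapply-of h h-acts (sandwich-cancel a b y)
      fixes-block : ∀ k → k ∈K → SetEq (image h (image k L)) (image k L)
      fixes-block k k∈K y =
        (λ y∈hkL → from-coset (subst L (cong (c ⁻¹ ∙_) (sandwich-cancel a b y))
                     (coset-stable c a∈L b∈L (subst L (cong (c ⁻¹ ∙_) h⁻¹y) (to-coset y∈hkL))))) ,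
        (λ y∈kL → from-coset (subst L (cong (c ⁻¹ ∙_) (sym h⁻¹y))
                     (coset-stable c (⁻¹∈ a∈L) (⁻¹∈ b∈L) (to-coset y∈kL))))
        where
        c = k ⟨$⟩ʳ ε
        to-coset : ∀ {z} → L (k ⟨$⟩ˡ z) → L (c ⁻¹ ∙ z)
        to-coset = proj₁ (block-is-coset k k∈K _)
        from-coset : ∀ {z} → L (c ⁻¹ ∙ z) → L (k ⟨$⟩ˡ z)
        from-coset = proj₂ (block-is-coset k k∈K _)

    right-∈K𝔏 : ∀ {s} → L s → K𝔏 (right s)
    right-∈K𝔏 {s} s∈L = L*⊆K𝔏 (right s) (right-∈K s)
      (λ x → trans (right-apply s x) (cong (_∙ s) (sym (identityˡ x)))) ε∈L s∈L

    conj-∈K𝔏 : ∀ {g} → L g → K𝔏 (two-sided g (g ⁻¹))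
    conj-∈K𝔏 {g} g∈L = L*⊆K𝔏 _ (two-sided-∈K g (g ⁻¹)) (two-sided-apply g (g ⁻¹)) g∈L (⁻¹∈ g∈L)
      where open IsNormalPredicate L⊴G using (⁻¹∈)

    record SubBlock (B : Subset n) : Set where
      field
        ⊆L         : ∀ {z} → z ∈ B → L z
        ε∈         : ε ∈ B
        nontrivial : ∃ λ z → z ∈ B × z ≢ ε
        condition  : BlockCondition K𝔏 (_∈ B)

    -- A SubBlock B is a subgroup normalised by L; it contains T, because
    -- B ∩ T is normalised by T, and if it were trivial then each z ∈ B
    -- would commute with T (all commutators [z, u] with u ∈ T lie in B ∩ T).
    module SubBlockProperties {B : Subset n} (B-sub : SubBlock B) where
      open SubBlock B-sub

      subgroup : IsSubgroupPredicate (_∈ B)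
      subgroup = BlockThroughε.subgroup condition ε∈ (λ s∈B → right-∈K𝔏 (⊆L s∈B))

      L-normalises : ∀ {g} → L g → ∀ {y} → y ∈ B → (g ∙ y ∙ g ⁻¹) ∈ B
      L-normalises g∈L = BlockThroughε.conj-closed condition ε∈ _ (conj-∈K𝔏 g∈L)

      T⊆B : T ⊆ B
      T⊆B {t} t∈T with T-simple (B ∩ T) (λ x∈B∩T → proj₂ (x∈p∩q⁻ B T x∈B∩T)) (∩-subgroup subgroup T.isSubgroup)
                               (λ g x g∈T x∈B∩T → let (x∈B , x∈T) = x∈p∩q⁻ B T x∈B∩T in
                                  x∈p∩q⁺ (L-normalises (T⊆L g∈T) x∈B , T.conj∈ g x∈T))
      ... | inj₂ T⊆B∩T = proj₁ (x∈p∩q⁻ B T (T⊆B∩T t∈T))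
      ... | inj₁ B∩T≡1 = ⊥-elim (z≢ε (centraliser-trivial z z-centralises))
        where
        z = proj₁ nontrivial
        z∈B = proj₁ (proj₂ nontrivial)
        z≢ε = proj₂ (proj₂ nontrivial)
        open IsSubgroupPredicate subgroup using (∙∈; ⁻¹∈)
        z-centralises : Centralises T z
        z-centralises u u∈T = commute-of-commutator z u (B∩T≡1 _ (x∈p∩q⁺ ([z,u]∈B , [z,u]∈T)))
          where
          [z,u]∈B : (z ∙ u ∙ z ⁻¹ ∙ u ⁻¹) ∈ B
          [z,u]∈B = subst (_∈ B) (trans (sym (assoc _ _ _)) (cong (_∙ u ⁻¹) (sym (assoc _ _ _))))
                      (∙∈ z∈B (L-normalises (T⊆L u∈T) (⁻¹∈ z∈B)))
          [z,u]∈T : (z ∙ u ∙ z ⁻¹ ∙ u ⁻¹) ∈ T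
          [z,u]∈T = T.∙∈ (T.conj∈ z u∈T) (T.⁻¹∈ u∈T)

    preimage : Perm → Subset n → Subset n
    preimage k B = Extension.set (extension λ w → (k ⟨$⟩ʳ w) ∈? B)

    preimage-sound : ∀ k {B x} → x ∈ preimage k B → (k ⟨$⟩ʳ x) ∈ B
    preimage-sound k {B} = Extension.sound (extension λ w → (k ⟨$⟩ʳ w) ∈? B)

    preimage-complete : ∀ k {B x} → (k ⟨$⟩ʳ x) ∈ B → x ∈ preimage k B
    preimage-complete k {B} = Extension.complete (extension λ w → (k ⟨$⟩ʳ w) ∈? B)

    preimage-condition : ∀ k → k ∈K → ∀ {B} → BlockCondition K𝔏 (_∈ B) → BlockCondition K𝔏 (_∈ preimage k B)
    preimage-condition k k∈K condition =
      condition-resp (condition-image condition (flip k) (K𝔏⊴K (flip k) (inv∈ k k∈K)))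
                     (λ _ → preimage-complete k , preimage-sound k)

    preimage-sub-block : ∀ k → k ∈K → Fixesε k → ∀ {B} → SubBlock B → SubBlock (preimage k B)
    preimage-sub-block k k∈K kε≡ε {B} B-sub = record
      { ⊆L         = λ w∈k⁻¹B → subst L (unapply-apply k) (stabiliser-preserves-Lˡ k k∈K kε≡ε (⊆L (sound w∈k⁻¹B)))
      ; ε∈         = complete (subst (_∈ B) (sym kε≡ε) ε∈)
      ; nontrivial = k ⟨$⟩ˡ z , complete (subst (_∈ B) (sym (apply-unapply k)) z∈B) ,
                     (λ k⁻¹z≡ε → z≢ε (trans (sym (apply-unapply k)) (trans (cong (k ⟨$⟩ʳ_) k⁻¹z≡ε) kε≡ε)))
      ; condition  = preimage-condition k k∈K condition
      }
      where
      open SubBlock B-sub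
      sound = preimage-sound k
      complete = preimage-complete k
      z = proj₁ nontrivial
      z∈B = proj₁ (proj₂ nontrivial)
      z≢ε = proj₂ (proj₂ nontrivial)

    -- The
    -- points z with k(z) ∈ B for all k ∈ K_ε form the intersection of the
    -- SubBlocks k⁻¹(B), a subgroup containing T and invariant under K_ε, hence
    -- a nontrivial block of K through ε.
    L⊆sub-block : ∀ {B} → SubBlock B → ∀ {z} → L z → z ∈ B
    L⊆sub-block {B} B-sub {z} z∈L = decidable-stable (z ∈? B)
      (¬¬-L⊆block (stabiliser-invariant-condition Core≤G Core-invariant) ε∈Core Core≢1 z∈L >>= λ z∈Core →
        pure (z∈Core id id∈ refl))
      where
      Core : Fin n → Set
      Core z = ∀ k → k ∈K → Fixesε k → (k ⟨$⟩ʳ z) ∈ B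

      module Sub (k : Perm) (k∈K : k ∈K) (kε≡ε : Fixesε k) =
        SubBlockProperties (preimage-sub-block k k∈K kε≡ε B-sub)

      ε∈Core : Core ε
      ε∈Core k _ kε≡ε = subst (_∈ B) (sym kε≡ε) (SubBlock.ε∈ B-sub)

      Core≤G : IsSubgroupPredicate Core
      Core≤G = record
        { ε∈  = ε∈Core
        ; ∙∈  = λ x∈ y∈ k k∈K kε≡ε → preimage-sound k (IsSubgroupPredicate.∙∈ (Sub.subgroup k k∈K kε≡ε)
                  (preimage-complete k (x∈ k k∈K kε≡ε)) (preimage-complete k (y∈ k k∈K kε≡ε)))
        ; ⁻¹∈ = λ x∈ k k∈K kε≡ε → preimage-sound k (IsSubgroupPredicate.⁻¹∈ (Sub.subgroup k k∈K kε≡ε)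
                  (preimage-complete k (x∈ k k∈K kε≡ε)))
        }

      Core-invariant : ∀ k′ → k′ ∈K → Fixesε k′ → ∀ {z} → Core z → Core (k′ ⟨$⟩ʳ z)
      Core-invariant k′ k′∈K k′ε≡ε z∈Core k k∈K kε≡ε =
        z∈Core (k′ ∘ₚ k) (∘∈ _ _ k′∈K k∈K) (trans (cong (k ⟨$⟩ʳ_) k′ε≡ε) kε≡ε)

      Core≢1 : ∃ λ t → Core t × t ≢ ε
      Core≢1 = let (t , t∈T , t≢ε) = T≢1 in
        t , (λ k k∈K kε≡ε → preimage-sound k (Sub.T⊆B k k∈K kε≡ε t∈T)) , t≢ε

    -- A set inside a coset cL with the block condition for K_𝔏 and two
    -- distinct points b₁, b₂ is all of cL: its translate b₁⁻¹ B is a SubBlock.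
    block-fills-coset : ∀ c {B} → (∀ {x} → x ∈ B → L (c ⁻¹ ∙ x)) → BlockCondition K𝔏 (_∈ B) →
                        ∀ {b₁ b₂} → b₁ ∈ B → b₂ ∈ B → b₂ ≢ b₁ → ∀ {x} → L (c ⁻¹ ∙ x) → x ∈ B
    block-fills-coset c {B} B⊆cL condition {b₁} {b₂} b₁∈B b₂∈B b₂≢b₁ {x} x∈cL =
      subst (_∈ B) (trans (left-apply b₁ _) (∙⁻¹-cancel b₁ x))
        (preimage-sound (left b₁) (L⊆sub-block b₁⁻¹B-sub (coset-quotientˡ c (B⊆cL b₁∈B) x∈cL)))
      where
      b₁[w]∈B⇒w∈L : ∀ {w} → (left b₁ ⟨$⟩ʳ w) ∈ B → L w
      b₁[w]∈B⇒w∈L {w} b₁w∈B = subst L (trans (cong (b₁ ⁻¹ ∙_) (left-apply b₁ w)) (⁻¹∙-cancel b₁ w))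
                                 (coset-quotientˡ c (B⊆cL b₁∈B) (B⊆cL b₁w∈B))
      b₁⁻¹B-sub : SubBlock (preimage (left b₁) B)
      b₁⁻¹B-sub = record
        { ⊆L         = λ w∈b₁⁻¹B → b₁[w]∈B⇒w∈L (preimage-sound (left b₁) w∈b₁⁻¹B)
        ; ε∈         = preimage-complete (left b₁) (subst (_∈ B) (sym (trans (left-apply b₁ ε) (identityʳ b₁))) b₁∈B)
        ; nontrivial = b₁ ⁻¹ ∙ b₂ ,
                       preimage-complete (left b₁)
                         (subst (_∈ B) (sym (trans (left-apply b₁ _) (∙⁻¹-cancel b₁ b₂))) b₂∈B) ,
                       (λ b₁⁻¹b₂≡ε → b₂≢b₁ (begin
                          b₂                 ≡⟨ ∙⁻¹-cancel b₁ b₂ ⟨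
                          b₁ ∙ (b₁ ⁻¹ ∙ b₂)  ≡⟨ cong (b₁ ∙_) b₁⁻¹b₂≡ε ⟩
                          b₁ ∙ ε             ≡⟨ identityʳ b₁ ⟩
                          b₁                 ∎))
        ; condition  = preimage-condition (left b₁) (left-∈K b₁) condition
        }

  -- Consequences not depending on a chosen socle (which exists classically,
  -- while the conclusions are ¬¬-stable).
  L*⊆K𝔏 : ∀ {a b} → L a → L b → K𝔏 (two-sided a b)
  L*⊆K𝔏 {a} {b} a∈L b∈L = K𝔏-stable _ (two-sided-∈K a b) (¬¬-socle >>= λ socle →
    pure (GivenSocle.L*⊆K𝔏 socle (two-sided a b) (two-sided-∈K a b) (two-sided-apply a b) a∈L b∈L))

  -- Results for a block X = k₀(L) of 𝔏, which is the coset k₀(ε) L.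
  module OnBlock (k₀ : Perm) (k₀∈K : k₀ ∈K) (X : Fin n → Set) (X≐k₀L : SetEq X (image k₀ L)) where
    c : Fin n
    c = k₀ ⟨$⟩ʳ ε

    X⊆cL : Socle → ∀ {x} → X x → L (c ⁻¹ ∙ x)
    X⊆cL socle {x} x∈X = proj₁ (GivenSocle.block-is-coset socle k₀ k₀∈K x) (proj₁ (X≐k₀L x) x∈X)

    -- K_𝔏 is transitive on X, via left translations by elements of L.
    transitive : ∀ x y → X x → X y → ∃ λ h → K𝔏 h × (h ⟨$⟩ʳ x ≡ y)
    transitive x y x∈X y∈X = two-sided (y ∙ x ⁻¹) ε , L*⊆K𝔏 yx⁻¹∈L ε∈L ,
      trans (two-sided-apply (y ∙ x ⁻¹) ε x) (trans (identityʳ _) (∙⁻¹∙-cancel x y))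
      where
      yx⁻¹∈L : L (y ∙ x ⁻¹)
      yx⁻¹∈L = L-stable _ (¬¬-socle >>= λ socle → pure (coset-quotientʳ c (X⊆cL socle x∈X) (X⊆cL socle y∈X)))

    blocks-trivial : ∀ (B : Subset n) → (∀ x → x ∈ B → X x) → IsBlock K𝔏 (_∈ B) →
                     (∀ x y → x ∈ B → y ∈ B → x ≡ y) ⊎ (∀ x → X x → x ∈ B)
    blocks-trivial B B⊆X B-block@((b₁ , b₁∈B) , _) with all? (λ y → (y ∈? B) →-dec (y ≟ᶠ b₁))
    ... | yes B-singleton = inj₁ λ x y x∈B y∈B → trans (B-singleton x x∈B) (sym (B-singleton y y∈B))
    ... | no  B-not-singleton = inj₂ λ x x∈X → decidable-stable (x ∈? B) (¬¬-socle >>= λ socle →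
          let (b₂ , b₂∈B , b₂≢b₁) = counterexample B (_≟ᶠ b₁) B-not-singleton in
          pure (GivenSocle.block-fills-coset socle c (λ y∈B → X⊆cL socle (B⊆X _ y∈B))
                  (block⇒condition B-block) b₁∈B b₂∈B b₂≢b₁ (X⊆cL socle x∈X)))

    contains-L* : ContainsLStarOn X
    contains-L* a b a∈L b∈L = two-sided a b , L*⊆K𝔏 a∈L b∈L , λ x _ → two-sided-apply a b x

lemma4p3 : ∀ {n : ℕ} (G : FinGroup n) (K : PermGroup n)
    → IsAlmostSimple G
    → Setting.ContainsGStar G K
    → ∀ (X : Fin n → Set) → Setting.In𝔏 G K X
    → PermTheory.IsPrimitiveOn (Setting.K𝔏 G K) X
    × Setting.ContainsLStarOn G K X
lemma4p3 G K almost-simple G*≤K X (k₀ , k₀∈K , X≐k₀L) = (transitive , blocks-trivial) , contains-L*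
  where open Argument.OnBlock G K almost-simple G*≤K k₀ k₀∈K X X≐k₀L
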